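{- Let $n\ge 2$ and let $w\in S_n$ be chosen uniformly at random. For $i,j\in[n]$ let $X_{ij}$ be the indicator of the event $w^{ -1}(i)>w^{ -1}(j)$. Set $L=\sum_{1\le i<j\le n}X_{ij}$, $D=\sum_{i=1}^{n-1}X_{i,i+1}$ and $X=L-\binom{D+1}{2}$. Then $\mathbb{E}[X]=\dfrac{3n^2-7n+2}{24}$. -}

module Defs where

open import Data.Nat as ℕ using (ℕ; zero; suc)
open import Data.Nat.Combinatorics using (_C_)
open import Data.Integer as ℤ using (ℤ; +_)
open import Data.Fin using (Fin; inject₁; _<?_)
open import Data.Fin.Permutation using (Permutation′; _⟨$⟩ʳ_; _⟨$⟩ˡ_)
open import Data.List using (List; map; foldr; allFin)
open import Data.Nat.ListAction using (sum)
open import Data.List.Relation.Unary.Any using (Any)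
open import Data.List.Relation.Unary.AllPairs using (AllPairs)
open import Data.Bool using (if_then_else_)
open import Relation.Nullary using (¬_)
open import Relation.Nullary.Decidable using (does)
open import Relation.Binary.PropositionalEquality using (_≡_)
open import Data.Product using (_×_)

-- Elements of [n] are represented by Fin n (i ↦ i+1). A permutation w ∈ S_n is
-- a 'Permutation′ n'; w ⟨$⟩ʳ a = w(a) and w ⟨$⟩ˡ i = w⁻¹(i).

Σ[_] : (n : ℕ) → (Fin n → ℕ) → ℕ
Σ[ n ] f = sum (map f (allFin n))

Xij : {n : ℕ} → Permutation′ n → Fin n → Fin n → ℕ
Xij w i j = if does ((w ⟨$⟩ˡ j) <? (w ⟨$⟩ˡ i)) then 1 else 0

L : {n : ℕ} → Permutation′ n → ℕ
L {n} w = Σ[ n ] (λ i → Σ[ n ] (λ j → if does (i <? j) then Xij w i j else 0))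

-- D = Σ_{i=1}^{n-1} X_{i,i+1}; for n = suc m the pairs (i, i+1) are (inject₁ k, suc k), k : Fin m
D : {n : ℕ} → Permutation′ n → ℕ
D {zero} w = 0
D {suc m} w = Σ[ m ] (λ k → Xij w (inject₁ k) (Fin.suc k))
  where import Data.Fin as Fin

X : {n : ℕ} → Permutation′ n → ℤ
X w = + L w ℤ.- + (suc (D w) C 2)

_≈ₚ_ : {n : ℕ} → Permutation′ n → Permutation′ n → Set
π ≈ₚ σ = ∀ i → π ⟨$⟩ʳ i ≡ σ ⟨$⟩ʳ i

EnumeratesSₙ : (n : ℕ) → List (Permutation′ n) → Set
EnumeratesSₙ n ps = (∀ (π : Permutation′ n) → Any (π ≈ₚ_) ps) × AllPairs (λ σ τ → ¬ (σ ≈ₚ τ)) ps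

Σℤ : List ℤ → ℤ
Σℤ = foldr ℤ._+_ (+ 0)

-- An expectation over Sₙ is a total over the enumeration divided by N. Relabelling the values
-- of w by a fixed permutation permutes the enumeration and so leaves totals unchanged; with
-- transpositions this gives 𝔼[X_ab] = 1/2 for a ≠ b, 𝔼[X_ab X_bc] = 1/6 for distinct a, b, c
-- and 𝔼[X_ab X_cd] = 1/4 for disjoint pairs. Linearity then yields 𝔼[L] = n(n-1)/4 and
-- 𝔼[D] = (n-1)/2, while writing D = X₁₂ + D′ and inducting on the number of terms yields
-- 𝔼[D²]; finally 2·C(D+1,2) = D² + D.
module Submission where

open import Defs
open import Level using (0ℓ)
open import Data.Nat as ℕ using (ℕ; zero; suc; _+_; _*_; _≤_; s≤s; z≤n)
open import Data.Nat.Properties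
  using (+-*-semiring; +-comm; +-identityʳ; *-identityʳ; *-assoc; *-distribˡ-+; *-distribʳ-+)
open import Data.Nat.Tactic.RingSolver using (solve-∀)
open import Data.Nat.Combinatorics using (_C_; nC1≡n; nCk+nC[k+1]≡[n+1]C[k+1])
open import Data.Nat.ListAction using (sum)
open import Data.Integer as ℤ using (+_)
open import Data.Integer.Properties using (pos-+; pos-*)
import Data.Integer.Tactic.RingSolver as ℤ-Solver
open import Data.Fin using (Fin; zero; suc; inject₁; _<_; _<?_)
open import Data.Fin.Properties
  using (_≟_; <-cmp; <-trans; <-asym; <⇒≢; ≤̄⇒inject₁<; ≤-refl; suc-injective)
open import Data.Fin.Permutation
  using (Permutation′; permutation; _⟨$⟩ʳ_; _⟨$⟩ˡ_; _∘ₚ_; flip; transpose; inverseˡ; inverseʳ)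
open import Data.List using (List; []; _∷_; map; length; lookup; tabulate)
open import Data.List.Properties using (map-tabulate)
open import Data.List.Membership.Propositional.Properties using (∈-lookup)
import Data.List.Membership.Setoid as SetoidMembership
import Data.List.Relation.Unary.Unique.Setoid as SetoidUnique
open import Data.List.Relation.Unary.All as All using ()
open import Data.List.Relation.Unary.AllPairs using (_∷_)
open import Data.List.Relation.Unary.Any as Any using ()
open import Data.List.Relation.Unary.Any.Properties using (lookup-index)
open import Data.Bool using (true; false; if_then_else_)
open import Data.Product using (_×_; _,_; proj₁; proj₂)
open import Data.Sum using (_⊎_; inj₁; inj₂)
open import Function.Base using (_∘_)
open import Function.Bundles using (Inverse)
open import Function.Definitions using (Injective)
open import Relation.Binary.Bundles using (Setoid)
open import Relation.Binary.Definitions using (tri<; tri≈; tri>)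
open import Relation.Binary.PropositionalEquality
open import Relation.Nullary using (¬_; does; yes; no)
open import Relation.Nullary.Decidable using (dec-true; dec-false)
open import Relation.Nullary.Negation using (contradiction; contraposition)
open import Algebra.Properties.Semiring.Sum +-*-semiring
  using (sum-syntax; sum-cong-≗; sum-replicate-zero; ∑-distrib-+; ∑-comm; ∑-permute; *-distribˡ-sum)
  renaming (sum to ∑)

private variable
  n m : ℕ

∑-const : ∀ m c → ∑[ k < m ] c ≡ m * c
∑-const zero    c = refl
∑-const (suc m) c = cong (λ s → c + s) (∑-const m c)

sum-tabulate : (f : Fin n → ℕ) → sum (tabulate f) ≡ ∑[ i < n ] f i
sum-tabulate {zero}  f = refl
sum-tabulate {suc n} f = cong (λ s → f zero + s) (sum-tabulate (f ∘ suc))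

Σ≡∑ : ∀ n (f : Fin n → ℕ) → Σ[ n ] f ≡ ∑[ i < n ] f i
Σ≡∑ n f = trans (cong sum (map-tabulate (λ i → i) f)) (sum-tabulate f)

2*[1+n]C2≡[1+n]*n : ∀ n → 2 * (suc n C 2) ≡ suc n * n
2*[1+n]C2≡[1+n]*n zero    = refl
2*[1+n]C2≡[1+n]*n (suc n) = begin
  2 * (suc (suc n) C 2)            ≡⟨ cong (2 *_) (nCk+nC[k+1]≡[n+1]C[k+1] (suc n) 1) ⟨
  2 * (suc n C 1 + suc n C 2)      ≡⟨ cong (λ k → 2 * (k + suc n C 2)) (nC1≡n (suc n)) ⟩
  2 * (suc n + suc n C 2)          ≡⟨ *-distribˡ-+ 2 (suc n) (suc n C 2) ⟩
  2 * suc n + 2 * (suc n C 2)      ≡⟨ cong (λ s → 2 * suc n + s) (2*[1+n]C2≡[1+n]*n n) ⟩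
  2 * suc n + suc n * n            ≡⟨ collect n ⟩
  suc (suc n) * suc n              ∎
  where
  open ≡-Reasoning
  collect : ∀ n → 2 * suc n + suc n * n ≡ suc (suc n) * suc n
  collect = solve-∀

module _ {a ℓ} (S : Setoid a ℓ) where
  open Setoid S using (Carrier; _≈_) renaming (sym to ≈-sym; trans to ≈-trans)
  open SetoidMembership S using (_∈_)
  open SetoidUnique S using (Unique)

  lookup-injective : ∀ {xs} → Unique xs → ∀ {i j} → lookup xs i ≈ lookup xs j → i ≡ j
  lookup-injective {_ ∷ _} _          {zero}  {zero}  _ = refl
  lookup-injective {_ ∷ _} (x≉xs ∷ _) {zero}  {suc j} e = contradiction e (All.lookup x≉xs (∈-lookup j))
  lookup-injective {_ ∷ _} (x≉xs ∷ _) {suc i} {zero}  e = contradiction (≈-sym e) (All.lookup x≉xs (∈-lookup i))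
  lookup-injective {_ ∷ _} (_ ∷ u)    {suc i} {suc j} e = cong suc (lookup-injective u e)

  module _ {xs : List Carrier} (unique : Unique xs) (complete : ∀ x → x ∈ xs) where

    position : Carrier → Fin (length xs)
    position x = Any.index (complete x)

    ≈-lookup-position : ∀ x → x ≈ lookup xs (position x)
    ≈-lookup-position x = lookup-index (complete x)

    position-cong : ∀ {x y} → x ≈ y → position x ≡ position y
    position-cong {x} {y} x≈y = lookup-injective unique
      (≈-trans (≈-sym (≈-lookup-position x)) (≈-trans x≈y (≈-lookup-position y)))

    position-lookup : ∀ i → position (lookup xs i) ≡ i
    position-lookup i = lookup-injective unique (≈-sym (≈-lookup-position (lookup xs i)))

    ∑-lookup-∘-inverse : (φ : Inverse S S) (f : Carrier → ℕ) → (∀ {x y} → x ≈ y → f x ≡ f y) →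
      ∑[ k < length xs ] f (lookup xs k) ≡ ∑[ k < length xs ] f (Inverse.to φ (lookup xs k))
    ∑-lookup-∘-inverse φ f f-cong = begin
      ∑[ k < length xs ] f (lookup xs k)                 ≡⟨ ∑-permute (λ k → f (lookup xs k)) reindex ⟩
      ∑[ k < length xs ] f (lookup xs (reindex ⟨$⟩ʳ k))  ≡⟨ sum-cong-≗ {length xs} lookup-reindex ⟩
      ∑[ k < length xs ] f (to (lookup xs k))            ∎
      where
      open ≡-Reasoning
      open Inverse φ
      position-inverse : {g h : Carrier → Carrier} →
                         (∀ {x y} → x ≈ y → g x ≈ g y) → (∀ x → g (h x) ≈ x) →
                         ∀ k → position (g (lookup xs (position (h (lookup xs k))))) ≡ k
      position-inverse {g} {h} g-cong g∘h≈id k = trans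
        (position-cong (≈-trans (g-cong (≈-sym (≈-lookup-position (h (lookup xs k)))))
                                (g∘h≈id (lookup xs k))))
        (position-lookup k)
      reindex : Permutation′ (length xs)
      reindex = permutation (λ k → position (to (lookup xs k))) (λ k → position (from (lookup xs k)))
        (position-inverse to-cong strictlyInverseˡ) (position-inverse from-cong strictlyInverseʳ)
      lookup-reindex : ∀ k → f (lookup xs (reindex ⟨$⟩ʳ k)) ≡ f (to (lookup xs k))
      lookup-reindex k = f-cong (≈-sym (≈-lookup-position (to (lookup xs k))))

transpose-left : (i j : Fin n) → transpose i j ⟨$⟩ʳ i ≡ j
transpose-left i j rewrite dec-true (i ≟ i) refl = refl

transpose-right : (i j : Fin n) → transpose i j ⟨$⟩ʳ j ≡ i
transpose-right i j with j ≟ i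
... | yes j≡i = j≡i
... | no _ rewrite dec-true (j ≟ j) refl = refl

transpose-other : {i j k : Fin n} → k ≢ i → k ≢ j → transpose i j ⟨$⟩ʳ k ≡ k
transpose-other {i = i} {j} {k} k≢i k≢j rewrite dec-false (k ≟ i) k≢i | dec-false (k ≟ j) k≢j = refl

𝟙[_>_] : Fin n → Fin n → ℕ
𝟙[ x > y ] = if does (y <? x) then 1 else 0

𝟙>-yes : {x y : Fin n} → y < x → 𝟙[ x > y ] ≡ 1
𝟙>-yes {x = x} {y} y<x = cong (if_then 1 else 0) (dec-true (y <? x) y<x)

𝟙>-no : {x y : Fin n} → ¬ y < x → 𝟙[ x > y ] ≡ 0
𝟙>-no {x = x} {y} y≮x = cong (if_then 1 else 0) (dec-false (y <? x) y≮x)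

𝟙>-≡1⇒> : {x y : Fin n} → 𝟙[ x > y ] ≡ 1 → y < x
𝟙>-≡1⇒> {x = x} {y} e with y <? x
... | yes y<x = y<x
... | no y≮x  = contradiction (trans (sym (𝟙>-no y≮x)) e) λ ()

𝟙>-idem : (x y : Fin n) → 𝟙[ x > y ] * 𝟙[ x > y ] ≡ 𝟙[ x > y ]
𝟙>-idem x y with does (y <? x)
... | true  = refl
... | false = refl

𝟙>-dichotomy : {x y : Fin n} → x ≢ y →
               (𝟙[ x > y ] ≡ 1 × 𝟙[ y > x ] ≡ 0) ⊎ (𝟙[ x > y ] ≡ 0 × 𝟙[ y > x ] ≡ 1)
𝟙>-dichotomy {x = x} {y} x≢y with <-cmp x y
... | tri< x<y _ y≮x = inj₂ (𝟙>-no y≮x , 𝟙>-yes x<y)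
... | tri≈ _ x≡y _   = contradiction x≡y x≢y
... | tri> x≮y _ y<x = inj₁ (𝟙>-yes y<x , 𝟙>-no x≮y)

𝟙>-flip : {x y : Fin n} → x ≢ y → 𝟙[ x > y ] + 𝟙[ y > x ] ≡ 1
𝟙>-flip x≢y with 𝟙>-dichotomy x≢y
... | inj₁ (e , f) rewrite e | f = refl
... | inj₂ (e , f) rewrite e | f = refl

-- If x > y, then z lies above x, between them, or below y.
𝟙>-split : {x y z : Fin n} → x ≢ y → y ≢ z → z ≢ x →
  𝟙[ x > y ] ≡ 𝟙[ z > x ] * 𝟙[ x > y ] + 𝟙[ x > z ] * 𝟙[ z > y ] + 𝟙[ x > y ] * 𝟙[ y > z ]
𝟙>-split {x = x} {y} {z} x≢y y≢z z≢x with 𝟙>-dichotomy x≢y | 𝟙>-dichotomy y≢z | 𝟙>-dichotomy z≢x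
... | inj₁ (xy , _) | inj₁ (yz , _) | inj₁ (zx , _) =
  contradiction (<-trans (𝟙>-≡1⇒> {x = y} yz) (𝟙>-≡1⇒> {x = x} xy)) (<-asym (𝟙>-≡1⇒> {x = z} zx))
... | inj₂ (_ , yx) | inj₂ (_ , zy) | inj₂ (_ , xz) =
  contradiction (<-trans (𝟙>-≡1⇒> {x = y} yx) (𝟙>-≡1⇒> {x = z} zy)) (<-asym (𝟙>-≡1⇒> {x = x} xz))
... | inj₁ (a , _) | inj₁ (c , d) | inj₂ (e , f) rewrite c | d | a | e | f = refl
... | inj₁ (a , _) | inj₂ (c , d) | inj₁ (e , f) rewrite c | d | a | e | f = refl
... | inj₁ (a , _) | inj₂ (c , d) | inj₂ (e , f) rewrite c | d | a | e | f = refl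
... | inj₂ (a , _) | inj₁ (c , d) | inj₁ (e , f) rewrite c | d | a | e | f = refl
... | inj₂ (a , _) | inj₁ (c , d) | inj₂ (e , f) rewrite c | d | a | e | f = refl
... | inj₂ (a , _) | inj₂ (c , d) | inj₁ (e , f) rewrite c | d | a | e | f = refl

≈ₚ-setoid : ℕ → Setoid 0ℓ 0ℓ
≈ₚ-setoid n = record
  { Carrier       = Permutation′ n
  ; _≈_           = _≈ₚ_
  ; isEquivalence = record
    { refl  = λ _ → refl
    ; sym   = λ π≈ρ i → sym (π≈ρ i)
    ; trans = λ π≈ρ ρ≈τ i → trans (π≈ρ i) (ρ≈τ i)
    }
  }

-- Relabelling the values of w by σ⁻¹: (w ∘ₚ flip σ) ⟨$⟩ˡ i = w ⟨$⟩ˡ (σ ⟨$⟩ʳ i), so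
-- Xij (w ∘ₚ flip σ) i j reduces to Xij w (σ ⟨$⟩ʳ i) (σ ⟨$⟩ʳ j).
relabelling : Permutation′ n → Inverse (≈ₚ-setoid n) (≈ₚ-setoid n)
relabelling σ = record
  { to        = _∘ₚ flip σ
  ; from      = _∘ₚ σ
  ; to-cong   = λ π≈ρ i → cong (σ ⟨$⟩ˡ_) (π≈ρ i)
  ; from-cong = λ π≈ρ i → cong (σ ⟨$⟩ʳ_) (π≈ρ i)
  ; inverse   = (λ π≈ρ i → trans (cong (σ ⟨$⟩ˡ_) (π≈ρ i)) (inverseˡ σ))
              , (λ π≈ρ i → trans (cong (σ ⟨$⟩ʳ_) (π≈ρ i)) (inverseʳ σ))
  }

⟨$⟩ˡ-cong : {π ρ : Permutation′ n} → π ≈ₚ ρ → ∀ i → π ⟨$⟩ˡ i ≡ ρ ⟨$⟩ˡ i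
⟨$⟩ˡ-cong {π = π} {ρ} π≈ρ i = begin
  π ⟨$⟩ˡ i                    ≡⟨ inverseˡ ρ ⟨
  ρ ⟨$⟩ˡ (ρ ⟨$⟩ʳ (π ⟨$⟩ˡ i))  ≡⟨ cong (ρ ⟨$⟩ˡ_) (π≈ρ (π ⟨$⟩ˡ i)) ⟨
  ρ ⟨$⟩ˡ (π ⟨$⟩ʳ (π ⟨$⟩ˡ i))  ≡⟨ cong (ρ ⟨$⟩ˡ_) (inverseʳ π) ⟩
  ρ ⟨$⟩ˡ i                    ∎
  where open ≡-Reasoning

⟨$⟩ˡ-injective : (w : Permutation′ n) {i j : Fin n} → w ⟨$⟩ˡ i ≡ w ⟨$⟩ˡ j → i ≡ j
⟨$⟩ˡ-injective w e = trans (sym (inverseʳ w)) (trans (cong (w ⟨$⟩ʳ_) e) (inverseʳ w))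

Xij-cong : {π ρ : Permutation′ n} → π ≈ₚ ρ → ∀ i j → Xij π i j ≡ Xij ρ i j
Xij-cong {π = π} {ρ} π≈ρ i j =
  cong₂ 𝟙[_>_] (⟨$⟩ˡ-cong {π = π} {ρ} π≈ρ i) (⟨$⟩ˡ-cong {π = π} {ρ} π≈ρ j)

Xij-flip : (w : Permutation′ n) {i j : Fin n} → i ≢ j → Xij w i j + Xij w j i ≡ 1
Xij-flip w i≢j = 𝟙>-flip (contraposition (⟨$⟩ˡ-injective w) i≢j)

Xij-split : (w : Permutation′ n) {a b c : Fin n} → a ≢ b → b ≢ c → c ≢ a →
  Xij w a b ≡ Xij w c a * Xij w a b + Xij w a c * Xij w c b + Xij w a b * Xij w b c
Xij-split w a≢b b≢c c≢a = 𝟙>-split (contraposition (⟨$⟩ˡ-injective w) a≢b)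
  (contraposition (⟨$⟩ˡ-injective w) b≢c) (contraposition (⟨$⟩ˡ-injective w) c≢a)

-- L and D taken along an injective labelling p of the values, so that induction can peel off p 0.
inversions : (Fin m → Fin n) → Permutation′ n → ℕ
inversions {m} p w = ∑[ i < m ] ∑[ j < m ] (if does (i <? j) then Xij w (p i) (p j) else 0)

descents : (Fin (suc m) → Fin n) → Permutation′ n → ℕ
descents {m} p w = ∑[ k < m ] Xij w (p (inject₁ k)) (p (suc k))

L≡inversions : (w : Permutation′ n) → L w ≡ inversions (λ i → i) w
L≡inversions {n} w = trans (Σ≡∑ n (λ i → Σ[ n ] (row i))) (sum-cong-≗ {n} (λ i → Σ≡∑ n (row i)))
  where
  row : Fin n → Fin n → ℕ
  row i j = if does (i <? j) then Xij w i j else 0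

D≡descents : (w : Permutation′ (suc m)) → D w ≡ descents (λ i → i) w
D≡descents {m} w = Σ≡∑ m (λ k → Xij w (inject₁ k) (suc k))

inject₁≢suc : (k : Fin m) → inject₁ k ≢ suc k
inject₁≢suc k = <⇒≢ (≤̄⇒inject₁< ≤-refl)

module Totals (ps : List (Permutation′ n)) (enumerates : EnumeratesSₙ n ps) where

  N : ℕ
  N = length ps

  total : (Permutation′ n → ℕ) → ℕ
  total f = ∑[ k < N ] f (lookup ps k)

  total-cong : {f g : Permutation′ n → ℕ} → (∀ w → f w ≡ g w) → total f ≡ total g
  total-cong f≗g = sum-cong-≗ {N} (λ k → f≗g (lookup ps k))

  total-+ : (f g : Permutation′ n → ℕ) → total (λ w → f w + g w) ≡ total f + total g
  total-+ f g = ∑-distrib-+ (λ k → f (lookup ps k)) (λ k → g (lookup ps k))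

  total-* : (c : ℕ) (f : Permutation′ n → ℕ) → total (λ w → c * f w) ≡ c * total f
  total-* c f = sym (*-distribˡ-sum c (λ k → f (lookup ps k)))

  total-1 : total (λ _ → 1) ≡ N
  total-1 = trans (∑-const N 1) (*-identityʳ N)

  total-∑ : (c M : ℕ) (g : Fin m → Permutation′ n → ℕ) → (∀ k → c * total (g k) ≡ M) →
            c * total (λ w → ∑[ k < m ] g k w) ≡ m * M
  total-∑ {m} c M g c*g≡M = begin
    c * total (λ w → ∑[ k < m ] g k w)  ≡⟨ cong (c *_) (∑-comm (λ i k → g k (lookup ps i))) ⟩
    c * ∑[ k < m ] total (g k)          ≡⟨ *-distribˡ-sum c (λ k → total (g k)) ⟩
    ∑[ k < m ] (c * total (g k))        ≡⟨ sum-cong-≗ {m} c*g≡M ⟩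
    ∑[ k < m ] M                        ≡⟨ ∑-const m M ⟩
    m * M                               ∎
    where open ≡-Reasoning

  total-relabel : (σ : Permutation′ n) (f : Permutation′ n → ℕ) →
                  (∀ {π ρ} → π ≈ₚ ρ → f π ≡ f ρ) → total f ≡ total (λ w → f (w ∘ₚ flip σ))
  total-relabel σ =
    ∑-lookup-∘-inverse (≈ₚ-setoid n) (proj₂ enumerates) (proj₁ enumerates) (relabelling σ)

  total-Xij*Xij-relabel : (σ : Permutation′ n) {a b c d a′ b′ c′ d′ : Fin n} →
    σ ⟨$⟩ʳ a ≡ a′ → σ ⟨$⟩ʳ b ≡ b′ → σ ⟨$⟩ʳ c ≡ c′ → σ ⟨$⟩ʳ d ≡ d′ →
    total (λ w → Xij w a b * Xij w c d) ≡ total (λ w → Xij w a′ b′ * Xij w c′ d′)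
  total-Xij*Xij-relabel σ {a} {b} {c} {d} refl refl refl refl =
    total-relabel σ (λ w → Xij w a b * Xij w c d)
      (λ {π} {ρ} π≈ρ → cong₂ _*_ (Xij-cong {π = π} {ρ} π≈ρ a b) (Xij-cong {π = π} {ρ} π≈ρ c d))

  total-Xij : {a b : Fin n} → a ≢ b → 2 * total (λ w → Xij w a b) ≡ N
  total-Xij {a} {b} a≢b = begin
    2 * t                                ≡⟨ cong (λ s → t + s) (+-identityʳ t) ⟩
    t + t                                ≡⟨ cong (λ s → t + s) swap ⟩
    t + total (λ w → Xij w b a)          ≡⟨ total-+ (λ w → Xij w a b) (λ w → Xij w b a) ⟨
    total (λ w → Xij w a b + Xij w b a)  ≡⟨ total-cong (λ w → Xij-flip w a≢b) ⟩
    total (λ _ → 1)                      ≡⟨ total-1 ⟩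
    N                                    ∎
    where
    open ≡-Reasoning
    t = total (λ w → Xij w a b)
    swap : t ≡ total (λ w → Xij w b a)
    swap = trans
      (total-relabel (transpose a b) (λ w → Xij w a b) (λ {π} {ρ} π≈ρ → Xij-cong {π = π} {ρ} π≈ρ a b))
      (cong₂ (λ x y → total (λ w → Xij w x y)) (transpose-left a b) (transpose-right a b))

  total-Xij*Xij-disjoint : {a b c d : Fin n} → a ≢ b → c ≢ d → c ≢ a → c ≢ b → d ≢ a → d ≢ b →
                           4 * total (λ w → Xij w a b * Xij w c d) ≡ N
  total-Xij*Xij-disjoint {a} {b} {c} {d} a≢b c≢d c≢a c≢b d≢a d≢b = begin
    4 * t                                          ≡⟨ *-assoc 2 2 t ⟩
    2 * (t + (t + 0))                              ≡⟨ cong (λ s → 2 * (t + s)) (+-identityʳ t) ⟩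
    2 * (t + t)                                    ≡⟨ cong (λ s → 2 * (t + s)) swap ⟩
    2 * (t + total X[ba]X[cd])                     ≡⟨ cong (2 *_) (total-+ X[ab]X[cd] X[ba]X[cd]) ⟨
    2 * total (λ w → X[ab]X[cd] w + X[ba]X[cd] w)  ≡⟨ cong (2 *_) (total-cong merge) ⟩
    2 * total (λ w → Xij w c d)                    ≡⟨ total-Xij c≢d ⟩
    N                                              ∎
    where
    open ≡-Reasoning
    X[ab]X[cd] X[ba]X[cd] : Permutation′ n → ℕ
    X[ab]X[cd] w = Xij w a b * Xij w c d
    X[ba]X[cd] w = Xij w b a * Xij w c d
    t = total X[ab]X[cd]
    swap : t ≡ total X[ba]X[cd]
    swap = total-Xij*Xij-relabel (transpose a b) (transpose-left a b) (transpose-right a b)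
             (transpose-other c≢a c≢b) (transpose-other d≢a d≢b)
    merge : ∀ w → X[ab]X[cd] w + X[ba]X[cd] w ≡ Xij w c d
    merge w = begin
      Xij w a b * Xij w c d + Xij w b a * Xij w c d  ≡⟨ *-distribʳ-+ (Xij w c d) (Xij w a b) (Xij w b a) ⟨
      (Xij w a b + Xij w b a) * Xij w c d            ≡⟨ cong (_* Xij w c d) (Xij-flip w a≢b) ⟩
      1 * Xij w c d                                  ≡⟨ +-identityʳ (Xij w c d) ⟩
      Xij w c d                                      ∎

  total-Xij*Xij-chain : {a b c : Fin n} → a ≢ b → b ≢ c → c ≢ a →
                        6 * total (λ w → Xij w a b * Xij w b c) ≡ N
  total-Xij*Xij-chain {a} {b} {c} a≢b b≢c c≢a = begin
    6 * t
      ≡⟨ *-assoc 2 3 t ⟩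
    2 * (3 * t)
      ≡⟨ cong (2 *_) (thrice t) ⟩
    2 * (t + t + t)
      ≡⟨ cong (λ s → 2 * (s + t)) (cong₂ _+_ c>a>b a>c>b) ⟩
    2 * (total (chain c a b) + total (chain a c b) + t)
      ≡⟨ cong (λ s → 2 * (s + t)) (total-+ (chain c a b) (chain a c b)) ⟨
    2 * (total (λ w → chain c a b w + chain a c b w) + t)
      ≡⟨ cong (2 *_) (total-+ (λ w → chain c a b w + chain a c b w) (chain a b c)) ⟨
    2 * total (λ w → chain c a b w + chain a c b w + chain a b c w)
      ≡⟨ cong (2 *_) (total-cong (λ w → sym (Xij-split w a≢b b≢c c≢a))) ⟩
    2 * total (λ w → Xij w a b)
      ≡⟨ total-Xij a≢b ⟩
    N
      ∎
    where
    open ≡-Reasoning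
    chain : Fin n → Fin n → Fin n → Permutation′ n → ℕ
    chain x y z w = Xij w x y * Xij w y z
    t = total (chain a b c)
    thrice : ∀ t → 3 * t ≡ t + t + t
    thrice = solve-∀
    a>c>b : t ≡ total (chain a c b)
    a>c>b = total-Xij*Xij-relabel (transpose b c) (transpose-other a≢b (c≢a ∘ sym))
              (transpose-left b c) (transpose-left b c) (transpose-right b c)
    c>a>b : t ≡ total (chain c a b)
    c>a>b = trans a>c>b (total-Xij*Xij-relabel (transpose a c) (transpose-left a c) (transpose-right a c)
              (transpose-right a c) (transpose-other (a≢b ∘ sym) b≢c))

  total-inversions : {p : Fin m → Fin n} → Injective _≡_ _≡_ p → 2 * total (inversions p) ≡ (m C 2) * N
  total-inversions {zero}  _ = cong (2 *_) (sum-replicate-zero N)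
  total-inversions {suc m} {p} p-inj = begin
    2 * total (inversions p)                 ≡⟨ cong (2 *_) (total-+ first-row (inversions (p ∘ suc))) ⟩
    2 * (total first-row + total (inversions (p ∘ suc)))
                                             ≡⟨ *-distribˡ-+ 2 (total first-row) (total (inversions (p ∘ suc))) ⟩
    2 * total first-row + 2 * total (inversions (p ∘ suc))
                                             ≡⟨ cong₂ _+_ (total-∑ 2 N (λ j w → Xij w (p zero) (p (suc j)))
                                                                 (λ j → total-Xij (contraposition p-inj λ ())))
                                                          (total-inversions (suc-injective ∘ p-inj)) ⟩
    m * N + (m C 2) * N                      ≡⟨ *-distribʳ-+ N m (m C 2) ⟨
    (m + m C 2) * N                          ≡⟨ cong (λ k → (k + m C 2) * N) (nC1≡n m) ⟨
    (m C 1 + m C 2) * N                      ≡⟨ cong (_* N) (nCk+nC[k+1]≡[n+1]C[k+1] m 1) ⟩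
    (suc m C 2) * N                          ∎
    where
    open ≡-Reasoning
    first-row : Permutation′ n → ℕ
    first-row w = ∑[ j < m ] Xij w (p zero) (p (suc j))

  total-descents : {p : Fin (suc m) → Fin n} → Injective _≡_ _≡_ p → 2 * total (descents p) ≡ m * N
  total-descents {p = p} p-inj = total-∑ 2 N (λ k w → Xij w (p (inject₁ k)) (p (suc k)))
    (λ k → total-Xij (contraposition p-inj (inject₁≢suc k)))

  total-Xij*descents : {p : Fin (3 + m) → Fin n} → Injective _≡_ _≡_ p →
    12 * total (λ w → Xij w (p zero) (p (suc zero)) * descents (p ∘ suc) w) ≡ (3 * m + 2) * N
  total-Xij*descents {m} {p} p-inj = begin
    12 * total (λ w → Y w * (Xij w p₁ p₂ + descents (λ i → p (suc (suc i))) w))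
      ≡⟨ cong (12 *_) (total-cong distribute) ⟩
    12 * total (λ w → Y[12] w + rest w)
      ≡⟨ cong (12 *_) (total-+ Y[12] rest) ⟩
    12 * (total Y[12] + total rest)
      ≡⟨ regroup (total Y[12]) (total rest) ⟩
    2 * (6 * total Y[12]) + 12 * total rest
      ≡⟨ cong₂ _+_ (cong (2 *_) (total-Xij*Xij-chain p₀≢p₁ p₁≢p₂ p₂≢p₀)) (total-∑ 12 (3 * N) g 12*total-g) ⟩
    2 * N + m * (3 * N)
      ≡⟨ collect m N ⟩
    (3 * m + 2) * N
      ∎
    where
    open ≡-Reasoning
    p₀ p₁ p₂ : Fin n
    p₀ = p zero
    p₁ = p (suc zero)
    p₂ = p (suc (suc zero))
    p₀≢p₁ : p₀ ≢ p₁
    p₀≢p₁ = contraposition p-inj λ ()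
    p₁≢p₂ : p₁ ≢ p₂
    p₁≢p₂ = contraposition p-inj λ ()
    p₂≢p₀ : p₂ ≢ p₀
    p₂≢p₀ = contraposition p-inj λ ()
    Y Y[12] : Permutation′ n → ℕ
    Y w = Xij w p₀ p₁
    Y[12] w = Y w * Xij w p₁ p₂
    X′ g : Fin m → Permutation′ n → ℕ
    X′ k w = Xij w (p (suc (suc (inject₁ k)))) (p (suc (suc (suc k))))
    g k w = Y w * X′ k w
    rest : Permutation′ n → ℕ
    rest w = ∑[ k < m ] g k w
    distribute : ∀ w → Y w * (Xij w p₁ p₂ + descents (λ i → p (suc (suc i))) w) ≡ Y[12] w + rest w
    distribute w = trans (*-distribˡ-+ (Y w) (Xij w p₁ p₂) (∑[ k < m ] X′ k w))
                         (cong (λ s → Y[12] w + s) (*-distribˡ-sum (Y w) (λ k → X′ k w)))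
    12*total-g : ∀ k → 12 * total (g k) ≡ 3 * N
    12*total-g k = trans (*-assoc 3 4 (total (g k))) (cong (3 *_) (total-Xij*Xij-disjoint p₀≢p₁
      (contraposition (suc-injective ∘ suc-injective ∘ p-inj) (inject₁≢suc k))
      (contraposition p-inj λ ()) (contraposition p-inj λ ())
      (contraposition p-inj λ ()) (contraposition p-inj λ ())))
    regroup : ∀ a b → 12 * (a + b) ≡ 2 * (6 * a) + 12 * b
    regroup = solve-∀
    collect : ∀ m N → 2 * N + m * (3 * N) ≡ (3 * m + 2) * N
    collect = solve-∀

  total-descents² : {p : Fin (2 + m) → Fin n} → Injective _≡_ _≡_ p →
    12 * total (λ w → descents p w * descents p w) ≡ (3 * m * m + 7 * m + 6) * N
  total-descents² {zero} {p} p-inj = begin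
    12 * total (λ w → descents p w * descents p w)  ≡⟨ cong (12 *_) (total-cong single) ⟩
    12 * total Y                                    ≡⟨ *-assoc 6 2 (total Y) ⟩
    6 * (2 * total Y)                               ≡⟨ cong (6 *_) (total-Xij (contraposition p-inj λ ())) ⟩
    6 * N                                           ∎
    where
    open ≡-Reasoning
    Y : Permutation′ n → ℕ
    Y w = Xij w (p zero) (p (suc zero))
    single : ∀ w → descents p w * descents p w ≡ Y w
    single w = trans (cong (λ y → y * y) (+-identityʳ (Y w))) (𝟙>-idem (w ⟨$⟩ˡ p zero) (w ⟨$⟩ˡ p (suc zero)))
  total-descents² {suc m} {p} p-inj = begin
    12 * total (λ w → descents p w * descents p w)
      ≡⟨ cong (12 *_) (total-cong expand) ⟩
    12 * total (λ w → Y w + 2 * YD′ w + D′² w)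
      ≡⟨ cong (12 *_) split ⟩
    12 * (total Y + 2 * total YD′ + total D′²)
      ≡⟨ regroup (total Y) (total YD′) (total D′²) ⟩
    6 * (2 * total Y) + 2 * (12 * total YD′) + 12 * total D′²
      ≡⟨ cong₂ _+_ (cong₂ _+_ (cong (6 *_) (total-Xij (contraposition p-inj λ ())))
                              (cong (2 *_) (total-Xij*descents p-inj)))
                   (total-descents² (suc-injective ∘ p-inj)) ⟩
    6 * N + 2 * ((3 * m + 2) * N) + (3 * m * m + 7 * m + 6) * N
      ≡⟨ collect m N ⟩
    (3 * suc m * suc m + 7 * suc m + 6) * N
      ∎
    where
    open ≡-Reasoning
    Y D′ YD′ D′² : Permutation′ n → ℕ
    Y w = Xij w (p zero) (p (suc zero))
    D′ = descents (λ i → p (suc i))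
    YD′ w = Y w * D′ w
    D′² w = D′ w * D′ w
    square : ∀ y d → (y + d) * (y + d) ≡ y * y + 2 * (y * d) + d * d
    square = solve-∀
    expand : ∀ w → descents p w * descents p w ≡ Y w + 2 * YD′ w + D′² w
    expand w = trans (square (Y w) (D′ w))
      (cong (λ y → y + 2 * YD′ w + D′² w) (𝟙>-idem (w ⟨$⟩ˡ p zero) (w ⟨$⟩ˡ p (suc zero))))
    split : total (λ w → Y w + 2 * YD′ w + D′² w) ≡ total Y + 2 * total YD′ + total D′²
    split = trans (total-+ (λ w → Y w + 2 * YD′ w) D′²)
      (cong (_+ total D′²) (trans (total-+ Y (λ w → 2 * YD′ w)) (cong (λ s → total Y + s) (total-* 2 YD′))))
    regroup : ∀ a b c → 12 * (a + 2 * b + c) ≡ 6 * (2 * a) + 2 * (12 * b) + 12 * c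
    regroup = solve-∀
    collect : ∀ m N → 6 * N + 2 * ((3 * m + 2) * N) + (3 * m * m + 7 * m + 6) * N
                    ≡ (3 * suc m * suc m + 7 * suc m + 6) * N
    collect = solve-∀

module Moments {m : ℕ} (ps : List (Permutation′ (2 + m))) (enumerates : EnumeratesSₙ (2 + m) ps) where
  open Totals ps enumerates

  [D+1]C2 : Permutation′ (2 + m) → ℕ
  [D+1]C2 w = suc (D w) C 2

  4*total-L : 4 * total L ≡ (2 + m) * (1 + m) * N
  4*total-L = begin
    4 * total L                              ≡⟨ *-assoc 2 2 (total L) ⟩
    2 * (2 * total L)                        ≡⟨ cong (λ t → 2 * (2 * t)) (total-cong L≡inversions) ⟩
    2 * (2 * total (inversions (λ i → i)))   ≡⟨ cong (2 *_) (total-inversions (λ e → e)) ⟩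
    2 * (((2 + m) C 2) * N)                  ≡⟨ *-assoc 2 ((2 + m) C 2) N ⟨
    2 * ((2 + m) C 2) * N                    ≡⟨ cong (_* N) (2*[1+n]C2≡[1+n]*n (1 + m)) ⟩
    (2 + m) * (1 + m) * N                    ∎
    where open ≡-Reasoning

  24*total-[D+1]C2 : 24 * total [D+1]C2 ≡ (3 * m + 4) * (m + 3) * N
  24*total-[D+1]C2 = begin
    24 * total [D+1]C2                               ≡⟨ *-assoc 12 2 (total [D+1]C2) ⟩
    12 * (2 * total [D+1]C2)                         ≡⟨ cong (12 *_) (total-* 2 [D+1]C2) ⟨
    12 * total (λ w → 2 * [D+1]C2 w)                 ≡⟨ cong (12 *_) (total-cong twice-[D+1]C2) ⟩
    12 * total (λ w → D′² w + D′ w)                  ≡⟨ cong (12 *_) (total-+ D′² D′) ⟩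
    12 * (total D′² + total D′)                      ≡⟨ regroup (total D′²) (total D′) ⟩
    12 * total D′² + 6 * (2 * total D′)              ≡⟨ cong₂ _+_ (total-descents² (λ e → e))
                                                                  (cong (6 *_) (total-descents (λ e → e))) ⟩
    (3 * m * m + 7 * m + 6) * N + 6 * ((1 + m) * N)  ≡⟨ collect m N ⟩
    (3 * m + 4) * (m + 3) * N                        ∎
    where
    open ≡-Reasoning
    D′ D′² : Permutation′ (2 + m) → ℕ
    D′ = descents (λ i → i)
    D′² w = D′ w * D′ w
    twice-[D+1]C2 : ∀ w → 2 * [D+1]C2 w ≡ D′² w + D′ w
    twice-[D+1]C2 w = trans (2*[1+n]C2≡[1+n]*n (D w))
      (trans (+-comm (D w) (D w * D w)) (cong (λ d → d * d + d) (D≡descents w)))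
    regroup : ∀ a b → 12 * (a + b) ≡ 12 * a + 6 * (2 * b)
    regroup = solve-∀
    collect : ∀ m N → (3 * m * m + 7 * m + 6) * N + 6 * ((1 + m) * N) ≡ (3 * m + 4) * (m + 3) * N
    collect = solve-∀

Σℤ-map-− : ∀ {A : Set} (f g : A → ℕ) (xs : List A) →
  Σℤ (map (λ x → + f x ℤ.- + g x) xs)
    ≡ + ∑[ k < length xs ] f (lookup xs k) ℤ.- + ∑[ k < length xs ] g (lookup xs k)
Σℤ-map-− f g []       = refl
Σℤ-map-− f g (x ∷ xs) = begin
  (+ f x ℤ.- + g x) ℤ.+ Σℤ (map (λ x → + f x ℤ.- + g x) xs)
    ≡⟨ cong (λ s → (+ f x ℤ.- + g x) ℤ.+ s) (Σℤ-map-− f g xs) ⟩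
  (+ f x ℤ.- + g x) ℤ.+ (+ F ℤ.- + G)
    ≡⟨ regroup (+ f x) (+ g x) (+ F) (+ G) ⟩
  (+ f x ℤ.+ + F) ℤ.- (+ g x ℤ.+ + G)
    ≡⟨ cong₂ ℤ._-_ (pos-+ (f x) F) (pos-+ (g x) G) ⟨
  + (f x + F) ℤ.- + (g x + G)
    ∎
  where
  open ≡-Reasoning
  F = ∑[ k < length xs ] f (lookup xs k)
  G = ∑[ k < length xs ] g (lookup xs k)
  regroup : ∀ a b c d → (a ℤ.- b) ℤ.+ (c ℤ.- d) ≡ (a ℤ.+ c) ℤ.- (b ℤ.+ d)
  regroup = ℤ-Solver.solve-∀

*-−-cross : ∀ k a b l c d → k * a + l * d ≡ l * c + k * b →
            + k ℤ.* (+ a ℤ.- + b) ≡ + l ℤ.* (+ c ℤ.- + d)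
*-−-cross k a b l c d eq = begin
  + k ℤ.* (+ a ℤ.- + b)
    ≡⟨ expand (+ k) (+ a) (+ b) (+ l) (+ d) ⟩
  (+ k ℤ.* + a ℤ.+ + l ℤ.* + d) ℤ.- (+ l ℤ.* + d ℤ.+ + k ℤ.* + b)
    ≡⟨ cong (ℤ._- (+ l ℤ.* + d ℤ.+ + k ℤ.* + b)) lifted ⟩
  (+ l ℤ.* + c ℤ.+ + k ℤ.* + b) ℤ.- (+ l ℤ.* + d ℤ.+ + k ℤ.* + b)
    ≡⟨ contract (+ k) (+ b) (+ l) (+ c) (+ d) ⟩
  + l ℤ.* (+ c ℤ.- + d)
    ∎
  where
  open ≡-Reasoning
  pos-*+* : ∀ x y u v → + (x * y + u * v) ≡ + x ℤ.* + y ℤ.+ + u ℤ.* + v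
  pos-*+* x y u v = trans (pos-+ (x * y) (u * v)) (cong₂ ℤ._+_ (pos-* x y) (pos-* u v))
  lifted : + k ℤ.* + a ℤ.+ + l ℤ.* + d ≡ + l ℤ.* + c ℤ.+ + k ℤ.* + b
  lifted = trans (sym (pos-*+* k a l d)) (trans (cong +_ eq) (pos-*+* l c k b))
  expand : ∀ k a b l d → k ℤ.* (a ℤ.- b) ≡ (k ℤ.* a ℤ.+ l ℤ.* d) ℤ.- (l ℤ.* d ℤ.+ k ℤ.* b)
  expand = ℤ-Solver.solve-∀
  contract : ∀ k b l c d → (l ℤ.* c ℤ.+ k ℤ.* b) ℤ.- (l ℤ.* d ℤ.+ k ℤ.* b) ≡ l ℤ.* (c ℤ.- d)
  contract = ℤ-Solver.solve-∀

lemma2p1 : (n : ℕ) → 2 ≤ n → (ps : List (Permutation′ n)) → EnumeratesSₙ n ps →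
    + 24 ℤ.* Σℤ (map X ps) ≡ + length ps ℤ.* (+ (3 ℕ.* n ℕ.* n ℕ.+ 2) ℤ.- + (7 ℕ.* n))
lemma2p1 n@(suc (suc m)) (s≤s (s≤s z≤n)) ps enumerates = begin
  + 24 ℤ.* Σℤ (map X ps)                     ≡⟨ cong (λ s → + 24 ℤ.* s) (Σℤ-map-− L [D+1]C2 ps) ⟩
  + 24 ℤ.* (+ total L ℤ.- + total [D+1]C2)   ≡⟨ *-−-cross 24 (total L) (total [D+1]C2) N _ _ counted ⟩
  + N ℤ.* (+ (3 * n * n + 2) ℤ.- + (7 * n))  ∎
  where
  open Totals ps enumerates
  open Moments ps enumerates
  open ≡-Reasoning
  identity : ∀ m N → 6 * ((2 + m) * (1 + m) * N) + N * (7 * (2 + m))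
                   ≡ N * (3 * (2 + m) * (2 + m) + 2) + (3 * m + 4) * (m + 3) * N
  identity = solve-∀
  counted : 24 * total L + N * (7 * n) ≡ N * (3 * n * n + 2) + 24 * total [D+1]C2
  counted = begin
    24 * total L + N * (7 * n)
      ≡⟨ cong (λ t → t + N * (7 * n)) (*-assoc 6 4 (total L)) ⟩
    6 * (4 * total L) + N * (7 * n)
      ≡⟨ cong (λ t → 6 * t + N * (7 * n)) 4*total-L ⟩
    6 * (n * (1 + m) * N) + N * (7 * n)
      ≡⟨ identity m N ⟩
    N * (3 * n * n + 2) + (3 * m + 4) * (m + 3) * N
      ≡⟨ cong (λ t → N * (3 * n * n + 2) + t) 24*total-[D+1]C2 ⟨
    N * (3 * n * n + 2) + 24 * total [D+1]C2
      ∎
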